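{- Let $A$ and $B$ be self-provers. If $\mathbf{QGL}\vdash\Box A\to(A\leftrightarrow B)$, then $\mathbf{QGL}\vdash A\leftrightarrow B$.
   Context: $\mathcal{L}''$ is the predicate modal language with individual variables, constants $\top,\bot$, connectives $\neg,\to,\lor,\land$, quantifiers $\forall,\exists$, modal operator $\Box$, countably many predicate symbols of each arity, and countably infinitely many propositional variables. $\mathbf{QGL}$ (over $\mathcal{L}''$): all instances of the axioms of classical first-order predicate logic, $\Box(A\to B)\to(\Box A\to\Box B)$, $\Box A\to\Box\Box A$, $\Box(\Box A\to A)\to\Box A$, with rules modus ponens, generalization and necessitation. An $\mathcal{L}''$-formula $A$ is a self-prover if $\mathbf{QGL}\vdash A\to\Box A$. -}

module Defs where

open import Data.Nat using (ℕ; _≡ᵇ_)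
open import Data.Bool using (Bool; true; false; _∧_; _∨_; not; if_then_else_; T)
open import Data.Vec using (Vec; map; foldr)

Var : Set
Var = ℕ

-- Formulas of the predicate modal language L''.
-- `pred n i xs` : the i-th predicate symbol of arity n applied to variables xs
-- (countably many predicate symbols of each arity; the only terms are variables).
-- `pvar i` : the i-th propositional variable.
infixr 6 _∧'_
infixr 5 _∨'_
infixr 4 _⇒_
data Form : Set where
  top bot : Form
  pred    : (n : ℕ) → ℕ → Vec Var n → Form
  pvar    : ℕ → Form
  ¬'_     : Form → Form
  _⇒_     : Form → Form → Form
  _∨'_    : Form → Form → Form
  _∧'_    : Form → Form → Form
  ∀'      : Var → Form → Form
  ∃'      : Var → Form → Form
  □       : Form → Form

infix 3 _⇔_
_⇔_ : Form → Form → Form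
A ⇔ B = (A ⇒ B) ∧' (B ⇒ A)

occursFree : Var → Form → Bool
occursFree x top = false
occursFree x bot = false
occursFree x (pred n i xs) = foldr (λ _ → Bool) (λ y b → (x ≡ᵇ y) ∨ b) false xs
occursFree x (pvar i) = false
occursFree x (¬' A) = occursFree x A
occursFree x (A ⇒ B) = occursFree x A ∨ occursFree x B
occursFree x (A ∨' B) = occursFree x A ∨ occursFree x B
occursFree x (A ∧' B) = occursFree x A ∨ occursFree x B
occursFree x (∀' z A) = not (x ≡ᵇ z) ∧ occursFree x A
occursFree x (∃' z A) = not (x ≡ᵇ z) ∧ occursFree x A
occursFree x (□ A) = occursFree x A

renVar : Var → Var → Var → Var
renVar y x z = if x ≡ᵇ z then y else z

subst : Form → Var → Var → Form
subst top y x = top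
subst bot y x = bot
subst (pred n i xs) y x = pred n i (map (renVar y x) xs)
subst (pvar i) y x = pvar i
subst (¬' A) y x = ¬' subst A y x
subst (A ⇒ B) y x = subst A y x ⇒ subst B y x
subst (A ∨' B) y x = subst A y x ∨' subst B y x
subst (A ∧' B) y x = subst A y x ∧' subst B y x
subst (∀' z A) y x = if x ≡ᵇ z then ∀' z A else ∀' z (subst A y x)
subst (∃' z A) y x = if x ≡ᵇ z then ∃' z A else ∃' z (subst A y x)
subst (□ A) y x = □ (subst A y x)

freeFor : Var → Var → Form → Bool
freeFor y x top = true
freeFor y x bot = true
freeFor y x (pred n i xs) = true
freeFor y x (pvar i) = true
freeFor y x (¬' A) = freeFor y x A
freeFor y x (A ⇒ B) = freeFor y x A ∧ freeFor y x B
freeFor y x (A ∨' B) = freeFor y x A ∧ freeFor y x B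
freeFor y x (A ∧' B) = freeFor y x A ∧ freeFor y x B
freeFor y x (∀' z A) = not (occursFree x (∀' z A)) ∨ (not (y ≡ᵇ z) ∧ freeFor y x A)
freeFor y x (∃' z A) = not (occursFree x (∃' z A)) ∨ (not (y ≡ᵇ z) ∧ freeFor y x A)
freeFor y x (□ A) = freeFor y x A

infix 2 QGL⊢_
data QGL⊢_ : Form → Set where
  ax-K     : ∀ {A B} → QGL⊢ A ⇒ (B ⇒ A)
  ax-S     : ∀ {A B C} → QGL⊢ (A ⇒ (B ⇒ C)) ⇒ ((A ⇒ B) ⇒ (A ⇒ C))
  ax-∧E₁   : ∀ {A B} → QGL⊢ A ∧' B ⇒ A
  ax-∧E₂   : ∀ {A B} → QGL⊢ A ∧' B ⇒ B
  ax-∧I    : ∀ {A B} → QGL⊢ A ⇒ (B ⇒ A ∧' B)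
  ax-∨I₁   : ∀ {A B} → QGL⊢ A ⇒ A ∨' B
  ax-∨I₂   : ∀ {A B} → QGL⊢ B ⇒ A ∨' B
  ax-∨E    : ∀ {A B C} → QGL⊢ (A ⇒ C) ⇒ ((B ⇒ C) ⇒ (A ∨' B ⇒ C))
  ax-¬I    : ∀ {A} → QGL⊢ (A ⇒ bot) ⇒ ¬' A
  ax-¬E    : ∀ {A} → QGL⊢ ¬' A ⇒ (A ⇒ bot)
  ax-¬¬    : ∀ {A} → QGL⊢ ¬' ¬' A ⇒ A
  ax-⊤     : QGL⊢ top
  ax-⊥     : ∀ {A} → QGL⊢ bot ⇒ A
  ax-∀E    : ∀ {A x y} → T (freeFor y x A) → QGL⊢ ∀' x A ⇒ subst A y x
  ax-∃I    : ∀ {A x y} → T (freeFor y x A) → QGL⊢ subst A y x ⇒ ∃' x A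
  ax-∀I    : ∀ {A B x} → T (not (occursFree x B)) → QGL⊢ ∀' x (B ⇒ A) ⇒ (B ⇒ ∀' x A)
  ax-∃E    : ∀ {A B x} → T (not (occursFree x B)) → QGL⊢ ∀' x (A ⇒ B) ⇒ (∃' x A ⇒ B)
  ax-□K    : ∀ {A B} → QGL⊢ □ (A ⇒ B) ⇒ (□ A ⇒ □ B)
  ax-□4    : ∀ {A} → QGL⊢ □ A ⇒ □ (□ A)
  ax-Löb   : ∀ {A} → QGL⊢ □ (□ A ⇒ A) ⇒ □ A
  mp       : ∀ {A B} → QGL⊢ A ⇒ B → QGL⊢ A → QGL⊢ B
  gen      : ∀ {A} x → QGL⊢ A → QGL⊢ ∀' x A
  nec      : ∀ {A} → QGL⊢ A → QGL⊢ □ A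

SelfProver : Form → Set
SelfProver A = QGL⊢ A ⇒ □ A

module Submission where

-- Split the hypothesis ⊢ □A → (A ↔ B) into its two halves
--   (1) ⊢ □A → (A → B)   and   (2) ⊢ □A → (B → A).
-- Whenever a formula C proves □A (⊢ C → □A), a conditional ⊢ □A → (C → D)
-- can be discharged to ⊢ C → D (the premise C is used twice).
--   * A → B : A is a self-prover, so ⊢ A → □A; discharge (1) with C = A.
--   * B → A : from (2), ⊢ B → (□A → A); necessitation, K and Löb's axiom
--     give ⊢ □B → □A, and since B is a self-prover, ⊢ B → □A; discharge (2)
--     with C = B.

open import Defs

⇒-refl : ∀ {X} → QGL⊢ X ⇒ X
⇒-refl {X} = mp (mp (ax-S {X} {X ⇒ X} {X}) ax-K) ax-K

⇒-trans : ∀ {X Y Z} → QGL⊢ X ⇒ Y → QGL⊢ Y ⇒ Z → QGL⊢ X ⇒ Z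
⇒-trans xy yz = mp (mp ax-S (mp ax-K yz)) xy

contract : ∀ {X Y} → QGL⊢ X ⇒ (X ⇒ Y) → QGL⊢ X ⇒ Y
contract h = mp (mp ax-S h) ⇒-refl

exchange : ∀ {X Y Z} → QGL⊢ X ⇒ (Y ⇒ Z) → QGL⊢ Y ⇒ (X ⇒ Z)
exchange h = ⇒-trans ax-K (mp ax-S h)

discharge-□ : ∀ {A C D} → QGL⊢ C ⇒ □ A → QGL⊢ □ A ⇒ (C ⇒ D) → QGL⊢ C ⇒ D
discharge-□ c□a h = contract (⇒-trans c□a h)

-- Löb step: if ⊢ □A → (B → A), i.e. ⊢ B → (□A → A), then ⊢ □B → □A.
-- By necessitation and K, □B implies □(□A → A), which implies □A by Löb.
löb-step : ∀ {A B} → QGL⊢ □ A ⇒ (B ⇒ A) → QGL⊢ □ B ⇒ □ A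
löb-step h = ⇒-trans (mp ax-□K (nec (exchange h))) ax-Löb

lemma6p5 : (A B : Form) → SelfProver A → SelfProver B →
    (QGL⊢ □ A ⇒ (A ⇔ B)) → (QGL⊢ A ⇔ B)
lemma6p5 A B selfA selfB h = mp (mp ax-∧I A⇒B) B⇒A
  where
    □A⇒A⇒B : QGL⊢ □ A ⇒ (A ⇒ B)
    □A⇒A⇒B = ⇒-trans h ax-∧E₁

    □A⇒B⇒A : QGL⊢ □ A ⇒ (B ⇒ A)
    □A⇒B⇒A = ⇒-trans h ax-∧E₂

    A⇒B : QGL⊢ A ⇒ B
    A⇒B = discharge-□ selfA □A⇒A⇒B

    B⇒□A : QGL⊢ B ⇒ □ A
    B⇒□A = ⇒-trans selfB (löb-step □A⇒B⇒A)

    B⇒A : QGL⊢ B ⇒ A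
    B⇒A = discharge-□ B⇒□A □A⇒B⇒A
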